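{- Let $n\ge 2k$ and let $\mathcal{F}\subseteq\binom{[n]}{k}$ be an MLCIF. Then: (a) for every $F\in\mathcal{F}$ there is some $i\in[k]$ with $F\leq_{\mathrm{LC}} Z_i$; (b) either $\mathcal{F}=\langle i\rangle$ for some $i\in[k]$, or $\mathcal{F}$ has at least two boundary sets.
   Context: For $G=\{y_1<\dots<y_k\}$, $F=\{x_1<\dots<x_k\}$ in $\binom{[n]}{k}$, write $G\leq_{\mathrm{LC}} F$ if $y_i\le x_i$ for all $i\in[k]$. A family $\mathcal{F}\subseteq\binom{[n]}{k}$ is left-compressed if it is closed under $\leq_{\mathrm{LC}}$-smaller sets; an MLCIF ($k$-uniform, on $[n]$) is a left-compressed intersecting family $\mathcal{F}\subseteq\binom{[n]}{k}$ maximal under inclusion among such families. For $i\in[k]$, $Z_i:=[i,2i-1]\cup[n-k+i+1,n]$, and $\langle i\rangle:=\{F\in\binom{[n]}{k}: |F\cap[2i-1]|\ge i\}$ (the $i$-th canonical MLCIF). A boundary set of $\mathcal{F}$ is a $\leq_{\mathrm{LC}}$-maximal element of $\mathcal{F}$, i.e. $B\in\mathcal{F}$ such that there is no $F\in\mathcal{F}$ with $F\ne B$ and $B\leq_{\mathrm{LC}} F$. -}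

module Defs where

open import Data.Nat using (ℕ; zero; suc; _+_; _∸_; _*_; _≤_; _<_; _≤?_)
open import Data.Nat.Properties using ()
open import Data.Fin as Fin using (Fin; toℕ)
open import Data.Vec using (Vec; lookup; tabulate; count)
open import Data.Bool using (Bool; T; if_then_else_)
open import Data.Product using (Σ; ∃; _×_; _,_)
open import Relation.Binary.PropositionalEquality using (_≡_; _≢_)
open import Relation.Nullary using (¬_)
open import Relation.Nullary.Decidable using (⌊_⌋)

-- A k-subset {x_1 < ... < x_k} of [n] = {1,...,n} is represented by the
-- vector (x_1, ..., x_k) of its elements in increasing order.
IsKSet : (n k : ℕ) → Vec ℕ k → Set
IsKSet n k v =
  (∀ (i j : Fin k) → i Fin.< j → lookup v i < lookup v j) ×
  (∀ (i : Fin k) → 1 ≤ lookup v i × lookup v i ≤ n)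

Family : ℕ → Set
Family k = Vec ℕ k → Bool

_∈F_ : ∀ {k} → Vec ℕ k → Family k → Set
v ∈F 𝓕 = T (𝓕 v)

InBinom : (n k : ℕ) → Family k → Set
InBinom n k 𝓕 = ∀ v → v ∈F 𝓕 → IsKSet n k v

_⊆F_ : ∀ {k} → Family k → Family k → Set
𝓕 ⊆F 𝓖 = ∀ v → v ∈F 𝓕 → v ∈F 𝓖

_≤LC_ : ∀ {k} → Vec ℕ k → Vec ℕ k → Set
_≤LC_ {k} G F = ∀ (i : Fin k) → lookup G i ≤ lookup F i

LeftCompressed : (n k : ℕ) → Family k → Set
LeftCompressed n k 𝓕 =
  ∀ F G → F ∈F 𝓕 → IsKSet n k G → G ≤LC F → G ∈F 𝓕

Intersecting : (k : ℕ) → Family k → Set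
Intersecting k 𝓕 =
  ∀ F G → F ∈F 𝓕 → G ∈F 𝓕 → Σ (Fin k) λ i → Σ (Fin k) λ j → lookup F i ≡ lookup G j

LCIF : (n k : ℕ) → Family k → Set
LCIF n k 𝓕 = InBinom n k 𝓕 × LeftCompressed n k 𝓕 × Intersecting k 𝓕

MLCIF : (n k : ℕ) → Family k → Set
MLCIF n k 𝓕 = LCIF n k 𝓕 × (∀ 𝓖 → LCIF n k 𝓖 → 𝓕 ⊆F 𝓖 → 𝓖 ⊆F 𝓕)

-- Z_i = [i, 2i-1] ∪ [n-k+i+1, n]  (i ∈ [k], 1-indexed), listed increasingly:
-- position j (0-indexed) holds i + j if j < i, and n - k + 1 + j otherwise.
Z : (n k i : ℕ) → Vec ℕ k
Z n k i = tabulate λ (j : Fin k) →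
  if ⌊ suc (toℕ j) ≤? i ⌋ then i + toℕ j else (n ∸ k) + 1 + toℕ j

-- ⟨i⟩ = { F ∈ binom([n],k) : |F ∩ [2i-1]| ≥ i }
InCanonical : (n k i : ℕ) → Vec ℕ k → Set
InCanonical n k i F = IsKSet n k F × i ≤ count (λ x → x ≤? (2 * i ∸ 1)) F

EqCanonical : (n k i : ℕ) → Family k → Set
EqCanonical n k i 𝓕 =
  ∀ F → (F ∈F 𝓕 → InCanonical n k i F) × (InCanonical n k i F → F ∈F 𝓕)

Boundary : ∀ {k} → Family k → Vec ℕ k → Set
Boundary 𝓕 B = B ∈F 𝓕 × (∀ F → F ∈F 𝓕 → B ≤LC F → F ≡ B)

-- (a) If x_i ≥ 2i for every i, left-compression puts {2, 4, …, 2k} and then {1, 3, …, 2k − 1}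
-- into 𝓕, and these are disjoint; so some x_i ≤ 2i − 1, and the entries of F, which increase by at
-- least one per position and are at most n, then fit under Z_i.
-- (b) 𝓕 is finite, so climbing in ≤LC from a member ends at a boundary set B. If all of 𝓕 lies
-- below B ≤LC Z_i, then 𝓕 ⊆ ⟨i⟩; since ⟨i⟩ is itself left-compressed and intersecting (two disjoint
-- sets cannot both meet [2i − 1] in i elements), maximality gives 𝓕 = ⟨i⟩. Otherwise climbing from
-- a member not below B reaches a second boundary set.
module Submission where

open import Defs
open import Data.Bool using (if_then_else_)
open import Data.Bool.Properties using (T?)
open import Data.Fin as Fin using (Fin; toℕ)
import Data.Fin.Properties as Fin
open import Data.Nat using (ℕ; zero; suc; _+_; _∸_; _*_; _≤_; _<_; _≤?_; _<?_; _≟_; z≤n; s≤s)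
open import Data.Nat.Properties
  using ( ≤-refl; ≤-trans; ≤-reflexive; ≤-antisym; <-irrefl; ≰⇒>; ≤∧≢⇒<; m≤n⇒m≤1+n; ≤-pred; 1+n≰n
        ; <⇒≱; ≤-<-trans; n≤1+n; m≤m+n; m≤n+m; 0≢1+n; suc-injective; m∸n+n≡m
        ; +-suc; +-comm; +-identityʳ; +-mono-≤; +-monoˡ-≤; +-monoʳ-≤; +-mono-<; +-cancelˡ-≤; +-cancelʳ-≤
        ; +-commutativeSemigroup; anyUpTo?; module ≤-Reasoning)
open import Algebra.Properties.CommutativeSemigroup +-commutativeSemigroup using (interchange)
open import Data.Nat.Tactic.RingSolver using (solve-∀)
open import Data.Product using (Σ; ∃; _×_; _,_; proj₁; proj₂)
open import Data.Sum using (_⊎_; inj₁; inj₂)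
open import Data.Vec using (Vec; []; _∷_; lookup; tabulate; count; sum)
open import Data.Vec.Properties using (lookup∘tabulate; ≡-dec)
open import Function using (_∘_)
open import Level using (Level)
open import Relation.Binary.PropositionalEquality using (_≡_; _≢_; refl; sym; trans; cong; cong₂; subst)
open import Relation.Nullary using (¬_; Dec; yes; no; contradiction)
open import Relation.Nullary.Decidable
  using (⌊_⌋; isYes≗does; dec-true; dec-false; map′; decidable-stable; toWitness; fromWitness
        ; ¬?; _×-dec_; _→-dec_)
open import Relation.Unary using (Pred; Decidable)

private
  variable
    k : ℕ

Increasing : Vec ℕ k → Set
Increasing {k} v = ∀ (i j : Fin k) → i Fin.< j → lookup v i < lookup v j

Positive : Vec ℕ k → Set
Positive {k} v = ∀ (i : Fin k) → 1 ≤ lookup v i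

Disjoint : Vec ℕ k → Vec ℕ k → Set
Disjoint {k} F G = ∀ (i j : Fin k) → lookup F i ≢ lookup G j

Bounded : ℕ → Vec ℕ k → Set
Bounded {k} n v = ∀ (i : Fin k) → lookup v i ≤ n

≤LC-refl : (F : Vec ℕ k) → F ≤LC F
≤LC-refl F i = ≤-refl

≤LC-trans : {F G H : Vec ℕ k} → F ≤LC G → G ≤LC H → F ≤LC H
≤LC-trans F≤G G≤H i = ≤-trans (F≤G i) (G≤H i)

_≤LC?_ : (G F : Vec ℕ k) → Dec (G ≤LC F)
G ≤LC? F = Fin.all? (λ i → lookup G i ≤? lookup F i)

IsKSet-≤LC : ∀ {n} {F G : Vec ℕ k} → IsKSet n k F → Increasing G → Positive G → G ≤LC F → IsKSet n k G
IsKSet-≤LC (_ , bounds) incG posG G≤F = incG , λ i → posG i , ≤-trans (G≤F i) (proj₂ (bounds i))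

InBinom-bounded : ∀ {n} {𝓕 : Family k} → InBinom n k 𝓕 → ∀ F → F ∈F 𝓕 → Bounded n F
InBinom-bounded inBinom F F∈ i = proj₂ (proj₂ (inBinom F F∈) i)

increasing-tail : ∀ {x} {v : Vec ℕ k} → Increasing (x ∷ v) → Increasing v
increasing-tail inc i j i<j = inc (Fin.suc i) (Fin.suc j) (s≤s i<j)

increasing-head : ∀ {x} {v : Vec ℕ k} → Increasing (x ∷ v) → ∀ j → x < lookup v j
increasing-head inc j = inc Fin.zero (Fin.suc j) (s≤s z≤n)

-- v_j ≥ v_i + (j − i), with both sides moved so that no subtraction occurs.
increasing-spread : (v : Vec ℕ k) → Increasing v → ∀ (i j : Fin k) → toℕ i ≤ toℕ j →
                    lookup v i + toℕ j ≤ lookup v j + toℕ i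
increasing-spread (x ∷ v) inc Fin.zero Fin.zero _ = ≤-refl
increasing-spread (x ∷ y ∷ v) inc Fin.zero (Fin.suc j) _ = begin
  x + suc (toℕ j)            ≡⟨ +-suc x (toℕ j) ⟩
  suc x + toℕ j              ≤⟨ +-monoˡ-≤ (toℕ j) (increasing-head inc Fin.zero) ⟩
  y + toℕ j                  ≤⟨ increasing-spread (y ∷ v) (increasing-tail inc) Fin.zero j z≤n ⟩
  lookup (y ∷ v) j + 0       ∎
  where open ≤-Reasoning
increasing-spread (x ∷ v) inc (Fin.suc i) (Fin.suc j) (s≤s i≤j) = begin
  lookup v i + suc (toℕ j)   ≡⟨ +-suc _ _ ⟩
  suc (lookup v i + toℕ j)   ≤⟨ s≤s (increasing-spread v (increasing-tail inc) i j i≤j) ⟩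
  suc (lookup v j + toℕ i)   ≡⟨ +-suc _ _ ⟨
  lookup v j + suc (toℕ i)   ∎
  where open ≤-Reasoning

module _ {ℓ : Level} {P : Pred ℕ ℓ} (P? : Decidable P) where

  count-∷-yes : ∀ {x} (v : Vec ℕ k) → P x → count P? (x ∷ v) ≡ suc (count P? v)
  count-∷-yes {x = x} v p rewrite dec-true (P? x) p = refl

  count-∷-no : ∀ {x} (v : Vec ℕ k) → ¬ P x → count P? (x ∷ v) ≡ count P? v
  count-∷-no {x = x} v ¬p rewrite dec-false (P? x) ¬p = refl

  count-none : (v : Vec ℕ k) → (∀ i → ¬ P (lookup v i)) → count P? v ≡ 0
  count-none []      _    = refl
  count-none (x ∷ v) none = trans (count-∷-no v (none Fin.zero)) (count-none v (none ∘ Fin.suc))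

  count-prefix : ∀ (v : Vec ℕ k) i → i ≤ k → (∀ j → toℕ j < i → P (lookup v j)) → i ≤ count P? v
  count-prefix v       zero    _         _      = z≤n
  count-prefix (x ∷ v) (suc i) (s≤s i≤k) prefix = begin
    suc i                ≤⟨ s≤s (count-prefix v i i≤k (λ j j<i → prefix (Fin.suc j) (s≤s j<i))) ⟩
    suc (count P? v)     ≡⟨ count-∷-yes v (prefix Fin.zero (s≤s z≤n)) ⟨
    count P? (x ∷ v)     ∎
    where open ≤-Reasoning

count≤ : ℕ → Vec ℕ k → ℕ
count≤ m = count (_≤? m)

count≡ : ℕ → Vec ℕ k → ℕ
count≡ m = count (_≟ m)

count≤-antitone : ∀ m (F G : Vec ℕ k) → G ≤LC F → count≤ m F ≤ count≤ m G
count≤-antitone m []      []      _   = z≤n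
count≤-antitone m (x ∷ F) (y ∷ G) G≤F with x ≤? m | y ≤? m
... | yes x≤m | yes y≤m rewrite count-∷-yes (_≤? m) F x≤m | count-∷-yes (_≤? m) G y≤m =
  s≤s (count≤-antitone m F G (G≤F ∘ Fin.suc))
... | yes x≤m | no y≰m = contradiction (≤-trans (G≤F Fin.zero) x≤m) y≰m
... | no x≰m  | yes y≤m rewrite count-∷-no (_≤? m) F x≰m | count-∷-yes (_≤? m) G y≤m =
  m≤n⇒m≤1+n (count≤-antitone m F G (G≤F ∘ Fin.suc))
... | no x≰m  | no y≰m rewrite count-∷-no (_≤? m) F x≰m | count-∷-no (_≤? m) G y≰m =
  count≤-antitone m F G (G≤F ∘ Fin.suc)

count≤-suc : ∀ m (v : Vec ℕ k) → count≤ (suc m) v ≡ count≤ m v + count≡ (suc m) v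
count≤-suc m []      = refl
count≤-suc m (x ∷ v) with x ≟ suc m
... | yes refl
  rewrite count-∷-yes (_≤? suc m) v (≤-refl {suc m}) | count-∷-no (_≤? m) v (1+n≰n {m})
        | count-∷-yes (_≟ suc m) v refl
  = trans (cong suc (count≤-suc m v)) (sym (+-suc _ _))
... | no x≢1+m with x ≤? m
...   | yes x≤m
  rewrite count-∷-yes (_≤? suc m) v (m≤n⇒m≤1+n x≤m) | count-∷-yes (_≤? m) v x≤m
        | count-∷-no (_≟ suc m) v x≢1+m
  = cong suc (count≤-suc m v)
...   | no x≰m
  rewrite count-∷-no (_≤? suc m) v (λ x≤1+m → x≰m (≤-pred (≤∧≢⇒< x≤1+m x≢1+m)))
        | count-∷-no (_≤? m) v x≰m | count-∷-no (_≟ suc m) v x≢1+m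
  = count≤-suc m v

count≤-zero : (v : Vec ℕ k) → Positive v → count≤ 0 v ≡ 0
count≤-zero v pos = count-none (_≤? 0) v (λ i i≤0 → 1+n≰n (≤-trans (pos i) i≤0))

count≡-absent : ∀ x (v : Vec ℕ k) → (∀ i → lookup v i ≢ x) → count≡ x v ≡ 0
count≡-absent x = count-none (_≟ x)

count≡-increasing : ∀ x (v : Vec ℕ k) → Increasing v → count≡ x v ≤ 1
count≡-increasing x []      _   = z≤n
count≡-increasing x (y ∷ v) inc with y ≟ x
... | yes refl rewrite count-∷-yes (_≟ y) v refl
                     | count≡-absent y v (λ i yᵢ≡y → <-irrefl (sym yᵢ≡y) (increasing-head inc i)) = ≤-refl
... | no y≢x rewrite count-∷-no (_≟ x) v y≢x = count≡-increasing x v (increasing-tail inc)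

count≡-disjoint : ∀ x (F G : Vec ℕ k) → Increasing F → Increasing G → Disjoint F G →
                  count≡ x F + count≡ x G ≤ 1
count≡-disjoint x F G incF incG disj with Fin.any? (λ i → lookup F i ≟ x)
... | yes (i , Fᵢ≡x) rewrite count≡-absent x G (λ j Gⱼ≡x → disj i j (trans Fᵢ≡x (sym Gⱼ≡x))) =
  ≤-trans (≤-reflexive (+-identityʳ _)) (count≡-increasing x F incF)
... | no x∉F rewrite count≡-absent x F (λ i Fᵢ≡x → x∉F (i , Fᵢ≡x)) = count≡-increasing x G incG

count≤-disjoint : ∀ m (F G : Vec ℕ k) → Increasing F → Increasing G → Positive F → Positive G →
                  Disjoint F G → count≤ m F + count≤ m G ≤ m
count≤-disjoint zero F G _ _ posF posG _ rewrite count≤-zero F posF | count≤-zero G posG = z≤n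
count≤-disjoint (suc m) F G incF incG posF posG disj = begin
  count≤ (suc m) F + count≤ (suc m) G
    ≡⟨ cong₂ _+_ (count≤-suc m F) (count≤-suc m G) ⟩
  (count≤ m F + count≡ (suc m) F) + (count≤ m G + count≡ (suc m) G)
    ≡⟨ interchange (count≤ m F) (count≡ (suc m) F) (count≤ m G) (count≡ (suc m) G) ⟩
  (count≤ m F + count≤ m G) + (count≡ (suc m) F + count≡ (suc m) G)
    ≤⟨ +-mono-≤ (count≤-disjoint m F G incF incG posF posG disj)
                (count≡-disjoint (suc m) F G incF incG disj) ⟩
  m + 1
    ≡⟨ +-comm m 1 ⟩
  suc m ∎
  where open ≤-Reasoning

double≢odd : ∀ i j → i + i ≢ suc (j + j)
double≢odd zero    j       ()
double≢odd (suc i) zero    e = 0≢1+n (sym (trans (sym (+-suc i i)) (suc-injective e)))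
double≢odd (suc i) (suc j) e =
  double≢odd i j (suc-injective (trans (sym (+-suc i i)) (trans (suc-injective e) (cong suc (+-suc j j)))))

odds : ∀ k → Vec ℕ k
odds k = tabulate λ (j : Fin k) → suc (toℕ j + toℕ j)

evens : ∀ k → Vec ℕ k
evens k = tabulate λ (j : Fin k) → suc (suc (toℕ j + toℕ j))

lookup-odds : (j : Fin k) → lookup (odds k) j ≡ suc (toℕ j + toℕ j)
lookup-odds = lookup∘tabulate _

lookup-evens : (j : Fin k) → lookup (evens k) j ≡ suc (suc (toℕ j + toℕ j))
lookup-evens = lookup∘tabulate _

evens-odds-disjoint : Disjoint (evens k) (odds k)
evens-odds-disjoint i j e =
  double≢odd (suc (toℕ i)) (toℕ j)
    (trans (cong suc (+-suc (toℕ i) (toℕ i))) (trans (sym (lookup-evens i)) (trans e (lookup-odds j))))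

odds-increasing : Increasing (odds k)
odds-increasing i j i<j rewrite lookup-odds i | lookup-odds j = s≤s (+-mono-< i<j i<j)

odds-positive : Positive (odds k)
odds-positive j rewrite lookup-odds j = s≤s z≤n

odds≤LCevens : odds k ≤LC evens k
odds≤LCevens j rewrite lookup-odds j | lookup-evens j = n≤1+n _

evens-IsKSet : ∀ n → 2 * k ≤ n → IsKSet n k (evens k)
evens-IsKSet {k} n 2k≤n = increasing , λ j → positive j , bounded j
  where
  increasing : Increasing (evens k)
  increasing i j i<j rewrite lookup-evens i | lookup-evens j =
    s≤s (s≤s (+-mono-< i<j i<j))
  positive : Positive (evens k)
  positive j rewrite lookup-evens j = s≤s z≤n
  bounded : ∀ j → lookup (evens k) j ≤ n
  bounded j rewrite lookup-evens j = begin
    suc (suc (toℕ j + toℕ j))  ≡⟨ cong suc (+-suc (toℕ j) (toℕ j)) ⟨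
    suc (toℕ j) + suc (toℕ j)  ≤⟨ +-mono-≤ (Fin.toℕ<n j) (Fin.toℕ<n j) ⟩
    k + k                      ≡⟨ cong (k +_) (+-identityʳ k) ⟨
    2 * k                      ≤⟨ 2k≤n ⟩
    n                          ∎
    where open ≤-Reasoning

lookup-Z-low : ∀ n i (j : Fin k) → toℕ j < i → lookup (Z n k i) j ≡ i + toℕ j
lookup-Z-low {k} n i j j<i =
  trans (lookup∘tabulate _ j)
        (cong (λ b → if b then i + toℕ j else n ∸ k + 1 + toℕ j)
              (trans (isYes≗does _) (dec-true (suc (toℕ j) ≤? i) j<i)))

lookup-Z-high : ∀ n i (j : Fin k) → ¬ toℕ j < i → lookup (Z n k i) j ≡ n ∸ k + 1 + toℕ j
lookup-Z-high {k} n i j j≮i =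
  trans (lookup∘tabulate _ j)
        (cong (λ b → if b then i + toℕ j else n ∸ k + 1 + toℕ j)
              (trans (isYes≗does _) (dec-false (suc (toℕ j) ≤? i) j≮i)))

-- The k − j entries after position j exceed F_j and are at most n.
IsKSet-room : ∀ n (F : Vec ℕ (suc k)) → IsKSet n (suc k) F → ∀ j → lookup F j + k ≤ n + toℕ j
IsKSet-room {k} n F (inc , bounds) j = begin
  lookup F j + k             ≡⟨ cong (lookup F j +_) (Fin.toℕ-fromℕ k) ⟨
  lookup F j + toℕ last      ≤⟨ increasing-spread F inc j last j≤last ⟩
  lookup F last + toℕ j      ≤⟨ +-monoˡ-≤ (toℕ j) (proj₂ (bounds last)) ⟩
  n + toℕ j                  ∎
  where
  open ≤-Reasoning
  last = Fin.fromℕ k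
  j≤last : toℕ j ≤ toℕ last
  j≤last = subst (toℕ j ≤_) (sym (Fin.toℕ-fromℕ k)) (Fin.toℕ≤pred[n] j)

-- With 1-indexed i = j₀ + 1: if x_i ≤ 2i − 1 then F ≤LC Z_i.
≤LC-Z : ∀ n (F : Vec ℕ k) → IsKSet n k F → k ≤ n → (j₀ : Fin k) →
        lookup F j₀ ≤ suc (toℕ j₀ + toℕ j₀) → F ≤LC Z n k (suc (toℕ j₀))
≤LC-Z {suc k} n F kset@(inc , _) k<n j₀ F[j₀]≤2j₀+1 j with toℕ j <? suc (toℕ j₀)
... | yes (s≤s j≤j₀) rewrite lookup-Z-low n (suc (toℕ j₀)) j (s≤s j≤j₀) =
  +-cancelʳ-≤ (toℕ j₀) _ _ (begin
    lookup F j + toℕ j₀              ≤⟨ increasing-spread F inc j j₀ j≤j₀ ⟩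
    lookup F j₀ + toℕ j              ≤⟨ +-monoˡ-≤ (toℕ j) F[j₀]≤2j₀+1 ⟩
    suc (toℕ j₀ + toℕ j₀) + toℕ j    ≡⟨ shuffle (toℕ j₀) (toℕ j) ⟩
    suc (toℕ j₀) + toℕ j + toℕ j₀    ∎)
  where
  open ≤-Reasoning
  shuffle : ∀ a b → suc (a + a) + b ≡ suc a + b + a
  shuffle = solve-∀
... | no j≮1+j₀ rewrite lookup-Z-high n (suc (toℕ j₀)) j j≮1+j₀ =
  +-cancelʳ-≤ k _ _ (begin
    lookup F j + k                   ≤⟨ IsKSet-room n F kset j ⟩
    n + toℕ j                        ≡⟨ cong (_+ toℕ j) (m∸n+n≡m k<n) ⟨
    n ∸ suc k + suc k + toℕ j        ≡⟨ shuffle (n ∸ suc k) (toℕ j) k ⟩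
    n ∸ suc k + 1 + toℕ j + k        ∎)
  where
  open ≤-Reasoning
  shuffle : ∀ d b c → d + suc c + b ≡ d + 1 + b + c
  shuffle = solve-∀

odds-IsKSet : ∀ n → 2 * k ≤ n → IsKSet n k (odds k)
odds-IsKSet {k} n 2k≤n =
  IsKSet-≤LC {F = evens k} {G = odds k} (evens-IsKSet n 2k≤n) odds-increasing odds-positive odds≤LCevens

LCIF-below-Z : ∀ n → 2 * k ≤ n → (𝓕 : Family k) → LCIF n k 𝓕 →
               ∀ F → F ∈F 𝓕 → Σ ℕ λ i → (1 ≤ i × i ≤ k) × F ≤LC Z n k i
LCIF-below-Z {k} n 2k≤n 𝓕 (inBinom , compressed , intersecting) F F∈𝓕
  with Fin.any? (λ j → lookup F j ≤? suc (toℕ j + toℕ j))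
... | yes (j₀ , small) =
  suc (toℕ j₀) , (s≤s z≤n , Fin.toℕ<n j₀) , ≤LC-Z n F (inBinom F F∈𝓕) (≤-trans (m≤m+n k _) 2k≤n) j₀ small
... | no noneSmall =
  let (a , b , e) = intersecting (evens k) (odds k) evens∈𝓕 odds∈𝓕
  in contradiction e (evens-odds-disjoint a b)
  where
  evens∈𝓕 : evens k ∈F 𝓕
  evens∈𝓕 = compressed F (evens k) F∈𝓕 (evens-IsKSet n 2k≤n)
    (λ j → subst (_≤ lookup F j) (sym (lookup-evens j)) (≰⇒> (λ small → noneSmall (j , small))))
  odds∈𝓕 : odds k ∈F 𝓕
  odds∈𝓕 = compressed (evens k) (odds k) evens∈𝓕 (odds-IsKSet n 2k≤n) odds≤LCevens

IsKSet? : ∀ n k (v : Vec ℕ k) → Dec (IsKSet n k v)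
IsKSet? n k v =
  Fin.all? (λ i → Fin.all? (λ j → (i Fin.<? j) →-dec (lookup v i <? lookup v j)))
  ×-dec Fin.all? (λ i → (1 ≤? lookup v i) ×-dec (lookup v i ≤? n))

InCanonical? : ∀ n k i (v : Vec ℕ k) → Dec (InCanonical n k i v)
InCanonical? n k i v = IsKSet? n k v ×-dec (i ≤? count≤ (2 * i ∸ 1) v)

canonical : ∀ n k → ℕ → Family k
canonical n k i v = ⌊ InCanonical? n k i v ⌋

below-pred-double : ∀ i j → j < i → i + j ≤ 2 * i ∸ 1
below-pred-double (suc i) j (s≤s j≤i) = begin
  suc (i + j)        ≤⟨ s≤s (+-monoʳ-≤ i j≤i) ⟩
  suc (i + i)        ≡⟨ +-suc i i ⟨
  i + suc i          ≡⟨ cong (λ m → i + suc m) (+-identityʳ i) ⟨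
  2 * suc i ∸ 1      ∎
  where open ≤-Reasoning

pred-double<double : ∀ i → 1 ≤ i → 2 * i ∸ 1 < i + i
pred-double<double (suc i) _ = s≤s (≤-reflexive (cong (λ m → i + suc m) (+-identityʳ i)))

canonical-LCIF : ∀ n k i → 1 ≤ i → LCIF n k (canonical n k i)
canonical-LCIF n k i 1≤i = inBinom , compressed , intersecting
  where
  inBinom : InBinom n k (canonical n k i)
  inBinom v v∈ = proj₁ (toWitness v∈)
  compressed : LeftCompressed n k (canonical n k i)
  compressed F G F∈ G-kset G≤F =
    fromWitness (G-kset , ≤-trans (proj₂ (toWitness F∈)) (count≤-antitone (2 * i ∸ 1) F G G≤F))
  intersecting : Intersecting k (canonical n k i)
  intersecting F G F∈ G∈ with Fin.any? (λ a → Fin.any? (λ b → lookup F a ≟ lookup G b))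
  ... | yes meet = meet
  ... | no disjoint =
    let ((incF , boundsF) , iF) = toWitness F∈
        ((incG , boundsG) , iG) = toWitness G∈
    in contradiction
         (≤-trans (+-mono-≤ iF iG)
           (count≤-disjoint (2 * i ∸ 1) F G incF incG (proj₁ ∘ boundsF) (proj₁ ∘ boundsG)
             (λ a b e → disjoint (a , b , e))))
         (<⇒≱ (pred-double<double i 1≤i))

≤LC-Z⇒InCanonical : ∀ n i → i ≤ k → (F : Vec ℕ k) → IsKSet n k F → F ≤LC Z n k i → InCanonical n k i F
≤LC-Z⇒InCanonical n i i≤k F kset F≤Z = kset , count-prefix (_≤? 2 * i ∸ 1) F i i≤k low
  where
  low : ∀ j → toℕ j < i → lookup F j ≤ 2 * i ∸ 1
  low j j<i = ≤-trans (F≤Z j) (subst (_≤ 2 * i ∸ 1) (sym (lookup-Z-low n i j j<i))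
                                     (below-pred-double i (toℕ j) j<i))

MLCIF-⊆-canonical : ∀ {n} {𝓕 : Family k} {i} → MLCIF n k 𝓕 → 1 ≤ i →
                    (∀ F → F ∈F 𝓕 → InCanonical n k i F) → EqCanonical n k i 𝓕
MLCIF-⊆-canonical {k} {n} {i = i} (_ , maximal) 1≤i 𝓕⊆ F =
  𝓕⊆ F , λ F∈ → maximal (canonical n k i) (canonical-LCIF n k i 1≤i) (λ G G∈ → fromWitness (𝓕⊆ G G∈))
                        F (fromWitness F∈)

≤LC⇒sum≤ : (G F : Vec ℕ k) → G ≤LC F → sum G ≤ sum F
≤LC⇒sum≤ []      []      _   = z≤n
≤LC⇒sum≤ (y ∷ G) (x ∷ F) G≤F = +-mono-≤ (G≤F Fin.zero) (≤LC⇒sum≤ G F (G≤F ∘ Fin.suc))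

≤LC∧sum≥⇒≡ : (G F : Vec ℕ k) → G ≤LC F → sum F ≤ sum G → G ≡ F
≤LC∧sum≥⇒≡ []      []      _   _ = refl
≤LC∧sum≥⇒≡ (y ∷ G) (x ∷ F) G≤F sumF≤sumG
  with refl ← ≤-antisym (G≤F Fin.zero)
                (+-cancelʳ-≤ (sum F) x y (≤-trans sumF≤sumG (+-monoʳ-≤ y (≤LC⇒sum≤ G F (G≤F ∘ Fin.suc)))))
  = cong (y ∷_) (≤LC∧sum≥⇒≡ G F (G≤F ∘ Fin.suc) (+-cancelˡ-≤ y _ _ sumF≤sumG))

sum-bounded : ∀ n (v : Vec ℕ k) → Bounded n v → sum v ≤ k * n
sum-bounded n []      _       = z≤n
sum-bounded n (x ∷ v) bounded = +-mono-≤ (bounded Fin.zero) (sum-bounded n v (bounded ∘ Fin.suc))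

any-bounded? : ∀ {ℓ} {P : Pred (Vec ℕ k) ℓ} n → Decidable P → Dec (∃ λ v → Bounded n v × P v)
any-bounded? {zero}  n P? = map′ (λ p → [] , (λ ()) , p) (λ { ([] , _ , p) → p }) (P? [])
any-bounded? {suc k} n P? =
  map′ (λ { (x , s≤s x≤n , v , bounded , p) → x ∷ v , (λ { Fin.zero → x≤n ; (Fin.suc i) → bounded i }) , p })
       (λ { (x ∷ v , bounded , p) → x , s≤s (bounded Fin.zero) , v , bounded ∘ Fin.suc , p })
       (anyUpTo? (λ x → any-bounded? n (P? ∘ (x ∷_))) (suc n))

≤LC∧≢⇒sum< : (F G : Vec ℕ k) → F ≤LC G → G ≢ F → sum F < sum G
≤LC∧≢⇒sum< F G F≤G G≢F = ≰⇒> (λ sumG≤sumF → G≢F (sym (≤LC∧sum≥⇒≡ F G F≤G sumG≤sumF)))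

-- Climbing strictly in ≤LC raises the sum, which stays at most k n, so the climb ends at a boundary set.
boundary-above : ∀ {n} (𝓕 : Family k) → (∀ F → F ∈F 𝓕 → Bounded n F) →
                 ∀ F → F ∈F 𝓕 → ∃ λ B → Boundary 𝓕 B × F ≤LC B
boundary-above {k} {n} 𝓕 bounded F F∈ = climb (k * n) F F∈ (m≤n+m (k * n) (sum F))
  where
  climb : ∀ fuel F → F ∈F 𝓕 → k * n ≤ sum F + fuel → ∃ λ B → Boundary 𝓕 B × F ≤LC B
  climb fuel F F∈ room with any-bounded? n (λ G → T? (𝓕 G) ×-dec (F ≤LC? G) ×-dec ¬? (≡-dec _≟_ G F))
  ... | no noneAbove = F , (F∈ , maximal) , ≤LC-refl F
    where
    maximal : ∀ G → G ∈F 𝓕 → F ≤LC G → G ≡ F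
    maximal G G∈ F≤G =
      decidable-stable (≡-dec _≟_ G F) (λ G≢F → noneAbove (G , bounded G G∈ , G∈ , F≤G , G≢F))
  ... | yes (G , _ , G∈ , F≤G , G≢F) with fuel | ≤LC∧≢⇒sum< F G F≤G G≢F
  ...   | zero     | F<G =
    contradiction (sum-bounded n G (bounded G G∈))
                  (<⇒≱ (≤-<-trans (subst (k * n ≤_) (+-identityʳ (sum F)) room) F<G))
  ...   | suc fuel | F<G =
    let (B , B-boundary , G≤B) = climb fuel G G∈ room′
    in B , B-boundary , ≤LC-trans {F = F} {G} {B} F≤G G≤B
    where
    open ≤-Reasoning
    room′ : k * n ≤ sum G + fuel
    room′ = begin
      k * n              ≤⟨ room ⟩
      sum F + suc fuel   ≡⟨ +-suc (sum F) fuel ⟩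
      suc (sum F) + fuel ≤⟨ +-monoˡ-≤ fuel F<G ⟩
      sum G + fuel       ∎

boundary-top-or-another : ∀ {n} (𝓕 : Family k) → (∀ F → F ∈F 𝓕 → Bounded n F) → ∀ {B} → Boundary 𝓕 B →
                          (∀ F → F ∈F 𝓕 → F ≤LC B) ⊎ (∃ λ B′ → B ≢ B′ × Boundary 𝓕 B′)
boundary-top-or-another {n = n} 𝓕 bounded {B} _ with any-bounded? n (λ F → T? (𝓕 F) ×-dec ¬? (F ≤LC? B))
... | no noneOutside =
  inj₁ λ F F∈ → decidable-stable (F ≤LC? B) (λ F≰B → noneOutside (F , bounded F F∈ , F∈ , F≰B))
... | yes (F , _ , F∈ , F≰B) =
  let (B′ , B′-boundary , F≤B′) = boundary-above 𝓕 bounded F F∈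
  in inj₂ (B′ , (λ B≡B′ → F≰B (subst (F ≤LC_) (sym B≡B′) F≤B′)) , B′-boundary)

MLCIF-inhabited : ∀ n → 1 ≤ k → 2 * k ≤ n → (𝓕 : Family k) → MLCIF n k 𝓕 → ∃ λ F → F ∈F 𝓕
MLCIF-inhabited {k} n 1≤k 2k≤n 𝓕 mlcif@((inBinom , _) , _) with any-bounded? n (T? ∘ 𝓕)
... | yes (F , _ , F∈) = F , F∈
... | no empty = odds k , proj₂ (MLCIF-⊆-canonical mlcif ≤-refl 𝓕⊆⟨1⟩ (odds k)) odds∈⟨1⟩
  where
  𝓕⊆⟨1⟩ : ∀ F → F ∈F 𝓕 → InCanonical n k 1 F
  𝓕⊆⟨1⟩ F F∈ = contradiction (F , InBinom-bounded inBinom F F∈ , F∈) empty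
  odds∈⟨1⟩ : InCanonical n k 1 (odds k)
  odds∈⟨1⟩ = odds-IsKSet n 2k≤n , count-prefix (_≤? 1) (odds k) 1 1≤k
    λ { Fin.zero _ → ≤-reflexive (lookup-odds {k} Fin.zero) ; (Fin.suc j) (s≤s ()) }

proposition2p3 : (n k : ℕ) → 1 ≤ k → 2 * k ≤ n → (𝓕 : Family k) → MLCIF n k 𝓕 →
    ((F : Vec ℕ k) → F ∈F 𝓕 → Σ ℕ λ i → (1 ≤ i × i ≤ k) × F ≤LC Z n k i)
    ×
    ((Σ ℕ λ i → (1 ≤ i × i ≤ k) × EqCanonical n k i 𝓕)
      ⊎ (Σ (Vec ℕ k) λ B₁ → Σ (Vec ℕ k) λ B₂ → B₁ ≢ B₂ × Boundary 𝓕 B₁ × Boundary 𝓕 B₂))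
proposition2p3 n k 1≤k 2k≤n 𝓕 mlcif@(lcif@(inBinom , _) , _) = below-Z , classification
  where
  below-Z : ∀ F → F ∈F 𝓕 → Σ ℕ λ i → (1 ≤ i × i ≤ k) × F ≤LC Z n k i
  below-Z = LCIF-below-Z n 2k≤n 𝓕 lcif
  bounded : ∀ F → F ∈F 𝓕 → Bounded n F
  bounded = InBinom-bounded inBinom
  classification : (Σ ℕ λ i → (1 ≤ i × i ≤ k) × EqCanonical n k i 𝓕)
      ⊎ (Σ (Vec ℕ k) λ B₁ → Σ (Vec ℕ k) λ B₂ → B₁ ≢ B₂ × Boundary 𝓕 B₁ × Boundary 𝓕 B₂)
  classification with MLCIF-inhabited n 1≤k 2k≤n 𝓕 mlcif
  ... | F , F∈ with boundary-above 𝓕 bounded F F∈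
  ... | B , B-boundary , _ with boundary-top-or-another 𝓕 bounded B-boundary
  ... | inj₂ (B′ , B≢B′ , B′-boundary) = inj₂ (B , B′ , B≢B′ , B-boundary , B′-boundary)
  ... | inj₁ 𝓕≤B with below-Z B (proj₁ B-boundary)
  ... | i , (1≤i , i≤k) , B≤Z = inj₁ (i , (1≤i , i≤k) , MLCIF-⊆-canonical mlcif 1≤i 𝓕⊆⟨i⟩)
    where
    𝓕⊆⟨i⟩ : ∀ G → G ∈F 𝓕 → InCanonical n k i G
    𝓕⊆⟨i⟩ G G∈ =
      ≤LC-Z⇒InCanonical n i i≤k G (inBinom G G∈) (≤LC-trans {F = G} {B} {Z n k i} (𝓕≤B G G∈) B≤Z)
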